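{- Let $p$ be a prime and let $A \subseteq \mathbb{Z}_p$ be a subset of size $n \geq 1$. Then either $$0 < h^c_p(A) < 3p^{(n-1)/n} + 1$$ or $$0 \leq h^c_p(A) - \frac{p}{b} < b$$ for some integer $b$ with $n \leq b \leq \lceil p^{1/n} \rceil$.
   Context: $\mathbb{Z}_p$ is the field of integers modulo the prime $p$, viewed as an additive group. For $A\subseteq\mathbb{Z}_p$ and a positive integer $k$, $kA$ denotes the $k$-fold sumset $A+\dots+A=\{x_1+\dots+x_k : x_i\in A\}$. For nonempty $A$, the coheight $h^c_p(A)$ is the least positive integer $k$ such that $0\in kA$. -}

module Defs where

open import Data.Nat using (ℕ; _≤_; _<_)
open import Data.Nat.Divisibility using (_∣_)
open import Data.Fin using (Fin; toℕ)
open import Data.Fin.Subset using (Subset; _∈_)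
open import Data.Vec using (sum; tabulate)
open import Data.Product using (∃; _×_)
open import Relation.Nullary using (¬_)

-- ℤ_p is represented by Fin p (residues 0,…,p-1); a subset A ⊆ ℤ_p is a
-- Data.Fin.Subset p.  Elements are added as natural numbers and the result
-- is compared modulo p.

ZeroInSumset : (p : ℕ) → Subset p → ℕ → Set
ZeroInSumset p A k =
  ∃ λ (x : Fin k → Fin p) → (∀ i → x i ∈ A) × (p ∣ sum (tabulate (λ i → toℕ (x i))))

IsCoheight : (p : ℕ) → Subset p → ℕ → Set
IsCoheight p A h =
  (1 ≤ h) × ZeroInSumset p A h × (∀ k → 1 ≤ k → k < h → ¬ ZeroInSumset p A k)

module Submission where

-- The first alternative follows once (h-1)λ < 3p for some λ with
-- p ≤ λⁿ.  If 0 ∈ A then h = 1; if n = 1 then h = p and b = 1 works.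
-- Otherwise let Lⁿ < p ≤ (L+1)ⁿ; L ≤ 1 is settled by h ≤ p.  For L ≥ 2,
-- cut [0,p) into L blocks of width s = ⌊(p-1)/L⌋ + 1; by pigeonhole on the
-- block patterns of (t·a)_{a∈A}, some t ≢ 0 moves every a within distance
-- < s of 0.  If the signs are mixed, two elements form a zero sum of length
-- < 2s, giving the first alternative.  Otherwise (replacing t by -t) all
-- residues t·a lie in [1, s): a *dilation* of A.  Dividing out the gcd of
-- the residues makes them coprime; then Bézout and pigeonhole show that
-- every class modulo the maximal residue M+1 is a sum of ≤ M residues, and
-- completing such sums by copies of the top element yields
--   p ≤ (M+1)h   and   (M+1)h ≤ J + M²  for each multiple J ≥ M² of p.
-- If Mⁿ < p, J = p gives b = M+1; otherwise M > L and J ≤ M² + p give the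
-- first alternative.

open import Defs
open import Data.Nat using (ℕ; _+_; _*_; _∸_; _^_; _≤_; _<_)
open import Data.Nat.Primality using (Prime)
open import Data.Fin.Subset using (Subset; ∣_∣)
open import Data.Product using (∃; _×_)
open import Data.Sum using (_⊎_)
open import Relation.Binary.PropositionalEquality using (_≡_)

open import Data.Nat using (zero; suc; z≤n; s≤s; s≤s⁻¹; NonZero; >-nonZero; ≢-nonZero; nonTrivial⇒n>1; _≟_; _≤?_; _<?_)
open import Data.Nat.Properties
open import Data.Nat.Divisibility using (_∣_; divides; ∣m+n∣m⇒∣n; n∣m*n; m∣m*n; ∣⇒≤; ∣-refl; ∣-trans; _∣0; 0∣⇒≡0)
open import Data.Nat.DivMod using (_/_; _%_; m≡m%n+[m/n]*n; m%n<n; m<n⇒m%n≡m; [m+kn]%n≡m%n; m/n*n≤m; m<n*o⇒m/o<n; m*[n/m]≡n; m≥n⇒m/n>0; /-monoˡ-≤; m/n≤m; m/n<m)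
open import Data.Nat.GCD using (gcd; gcd[m,n]∣m; gcd[m,n]∣n; gcd-GCD; module Bézout)
open import Data.Nat.Coprimality using (prime⇒coprime; coprime-Bézout)
open import Data.Nat.Primality using (euclidsLemma; prime⇒nonZero; prime⇒nonTrivial)
open import Data.Nat.Tactic.RingSolver using (solve-∀)
open import Data.Fin as Fin using (Fin; toℕ; fromℕ<)
import Data.Fin.Properties as Finₚ
open import Data.Fin.Subset using (_∈_; _∉_; inside; outside)
open import Data.Fin.Subset.Properties using (_∈?_)
open import Data.Vec as Vec using (_∷_; here; there)
open import Data.List as List using (List; []; _∷_; _++_; length; replicate)
open import Data.List.Properties using (length-++; length-replicate; length-tabulate; length-take; length-drop; take++drop≡id)
open import Data.List.Relation.Unary.All as All using (All; []; _∷_)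
import Data.List.Relation.Unary.All.Properties as Allₚ
open import Data.Product using (_,_; proj₁; proj₂)
open import Data.Sum using (inj₁; inj₂)
import Data.Sum
open import Data.Empty using (⊥-elim)
open import Level using (0ℓ)
open import Relation.Nullary using (¬_; yes; no; Dec)
open import Relation.Binary.Bundles using (Setoid)
import Relation.Binary.Reasoning.Setoid as SetoidReasoning
open import Relation.Binary.PropositionalEquality using (refl; sym; trans; cong; cong₂; subst; subst₂; _≢_; module ≡-Reasoning)

-- Congruence of natural numbers modulo m, in a symmetric form that needs
-- no subtraction:  x ≡ y mod m  iff  x + k₁m = y + k₂m  for some k₁, k₂.

infix 4 _≡_mod_
record _≡_mod_ (x y m : ℕ) : Set where
  constructor balance
  field
    k₁ k₂ : ℕ
    balanced : x + k₁ * m ≡ y + k₂ * m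

≡mod-refl : ∀ {m} x → x ≡ x mod m
≡mod-refl x = balance 0 0 refl

≡⇒≡mod : ∀ {m x y} → x ≡ y → x ≡ y mod m
≡⇒≡mod refl = ≡mod-refl _

≡mod-sym : ∀ {m x y} → x ≡ y mod m → y ≡ x mod m
≡mod-sym (balance a b e) = balance b a (sym e)

≡mod-trans : ∀ {m x y z} → x ≡ y mod m → y ≡ z mod m → x ≡ z mod m
≡mod-trans {m} {x} {y} {z} (balance a b e₁) (balance c d e₂) = balance (a + c) (d + b) (begin
  x + (a + c) * m       ≡⟨ shuffle x a c m ⟩
  (x + a * m) + c * m   ≡⟨ cong (_+ c * m) e₁ ⟩
  (y + b * m) + c * m   ≡⟨ swap y b c m ⟩
  (y + c * m) + b * m   ≡⟨ cong (_+ b * m) e₂ ⟩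
  (z + d * m) + b * m   ≡⟨ sym (shuffle z d b m) ⟩
  z + (d + b) * m       ∎)
  where
  open ≡-Reasoning
  shuffle : ∀ x a c m → x + (a + c) * m ≡ (x + a * m) + c * m
  shuffle = solve-∀
  swap : ∀ y b c m → (y + b * m) + c * m ≡ (y + c * m) + b * m
  swap = solve-∀

mod-setoid : ℕ → Setoid 0ℓ 0ℓ
mod-setoid m = record
  { Carrier = ℕ
  ; _≈_ = λ x y → x ≡ y mod m
  ; isEquivalence = record { refl = ≡mod-refl _ ; sym = ≡mod-sym ; trans = ≡mod-trans } }

module ≡mod-Reasoning (m : ℕ) = SetoidReasoning (mod-setoid m)

≡mod-+ : ∀ {m x₁ y₁ x₂ y₂} → x₁ ≡ y₁ mod m → x₂ ≡ y₂ mod m → x₁ + x₂ ≡ y₁ + y₂ mod m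
≡mod-+ {m} {x₁} {y₁} {x₂} {y₂} (balance a b e₁) (balance c d e₂) = balance (a + c) (b + d) (begin
  x₁ + x₂ + (a + c) * m         ≡⟨ regroup x₁ x₂ a c m ⟩
  (x₁ + a * m) + (x₂ + c * m)   ≡⟨ cong₂ _+_ e₁ e₂ ⟩
  (y₁ + b * m) + (y₂ + d * m)   ≡⟨ sym (regroup y₁ y₂ b d m) ⟩
  y₁ + y₂ + (b + d) * m         ∎)
  where
  open ≡-Reasoning
  regroup : ∀ x₁ x₂ a c m → x₁ + x₂ + (a + c) * m ≡ (x₁ + a * m) + (x₂ + c * m)
  regroup = solve-∀

≡mod-* : ∀ {m x₁ y₁ x₂ y₂} → x₁ ≡ y₁ mod m → x₂ ≡ y₂ mod m → x₁ * x₂ ≡ y₁ * y₂ mod m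
≡mod-* {m} {x₁} {y₁} {x₂} {y₂} (balance a b e₁) (balance c d e₂) =
  balance (x₁ * c + a * x₂ + a * c * m) (y₁ * d + b * y₂ + b * d * m) (begin
    x₁ * x₂ + (x₁ * c + a * x₂ + a * c * m) * m   ≡⟨ expand x₁ x₂ a c m ⟩
    (x₁ + a * m) * (x₂ + c * m)                   ≡⟨ cong₂ _*_ e₁ e₂ ⟩
    (y₁ + b * m) * (y₂ + d * m)                   ≡⟨ sym (expand y₁ y₂ b d m) ⟩
    y₁ * y₂ + (y₁ * d + b * y₂ + b * d * m) * m   ∎)
  where
  open ≡-Reasoning
  expand : ∀ x₁ x₂ a c m → x₁ * x₂ + (x₁ * c + a * x₂ + a * c * m) * m ≡ (x₁ + a * m) * (x₂ + c * m)
  expand = solve-∀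

≡mod-*ˡ : ∀ {m x y} k → x ≡ y mod m → k * x ≡ k * y mod m
≡mod-*ˡ k = ≡mod-* (≡mod-refl k)

≡mod-cancelˡ : ∀ {m x y} k → k + x ≡ k + y mod m → x ≡ y mod m
≡mod-cancelˡ {m} {x} {y} k (balance a b e) =
  balance a b (+-cancelˡ-≡ k _ _ (trans (sym (+-assoc k x (a * m))) (trans e (+-assoc k y (b * m)))))

multiple≡0 : ∀ {m} k → k * m ≡ 0 mod m
multiple≡0 k = balance 0 k (+-identityʳ _)

≡0⇒∣ : ∀ {m x} → x ≡ 0 mod m → m ∣ x
≡0⇒∣ {m} {x} (balance a b e) =
  ∣m+n∣m⇒∣n (subst (m ∣_) (trans (sym e) (+-comm x (a * m))) (n∣m*n b)) (n∣m*n a)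

∣⇒≡0 : ∀ {m x} → m ∣ x → x ≡ 0 mod m
∣⇒≡0 {m} {x} (divides q e) = balance 0 q (trans (+-identityʳ x) e)

≡%  : ∀ {m} .{{_ : NonZero m}} x → x ≡ x % m mod m
≡% {m} x = balance 0 (x / m) (trans (+-identityʳ x) (m≡m%n+[m/n]*n x m))

%≡⇒≡mod : ∀ {m} .{{_ : NonZero m}} {x y} → x % m ≡ y % m → x ≡ y mod m
%≡⇒≡mod {m} {x} {y} e = ≡mod-trans (≡% x) (≡mod-trans (≡⇒≡mod e) (≡mod-sym (≡% y)))

≡mod⇒≡ : ∀ {m x y} → x ≡ y mod m → x < m → y < m → x ≡ y
≡mod⇒≡ {suc m} {x} {y} (balance a b e) x<m y<m = begin
  x                         ≡⟨ m<n⇒m%n≡m x<m ⟨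
  x % suc m                 ≡⟨ [m+kn]%n≡m%n x a (suc m) ⟨
  (x + a * suc m) % suc m   ≡⟨ cong (_% suc m) e ⟩
  (y + b * suc m) % suc m   ≡⟨ [m+kn]%n≡m%n y b (suc m) ⟩
  y % suc m                 ≡⟨ m<n⇒m%n≡m y<m ⟩
  y                         ∎
  where open ≡-Reasoning

difference-≤ : ∀ {m} .{{_ : NonZero m}} {a d b} → a + d ≡ b mod m → a % m ≤ b % m →
               d ≡ b % m ∸ a % m mod m
difference-≤ {m} {a} {d} {b} c le = ≡mod-cancelˡ (a % m) (begin
  a % m + d                 ≈⟨ ≡mod-+ (≡mod-sym (≡% a)) (≡mod-refl d) ⟩
  a + d                     ≈⟨ c ⟩
  b                         ≈⟨ ≡% b ⟩
  b % m                     ≡⟨ m+[n∸m]≡n le ⟨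
  a % m + (b % m ∸ a % m)   ∎)
  where open ≡mod-Reasoning m

difference-≥ : ∀ {m} .{{_ : NonZero m}} {a d b} → a + d ≡ b mod m → b % m ≤ a % m →
               d + (a % m ∸ b % m) ≡ 0 mod m
difference-≥ {m} {a} {d} {b} c le = ≡mod-cancelˡ (b % m) (begin
  b % m + (d + (a % m ∸ b % m))   ≡⟨ regroup (b % m) d (a % m ∸ b % m) ⟩
  (b % m + (a % m ∸ b % m)) + d   ≡⟨ cong (_+ d) (m+[n∸m]≡n le) ⟩
  a % m + d                       ≈⟨ ≡mod-+ (≡mod-sym (≡% a)) (≡mod-refl d) ⟩
  a + d                           ≈⟨ c ⟩
  b                               ≈⟨ ≡% b ⟩
  b % m                           ≡⟨ +-identityʳ (b % m) ⟨
  b % m + 0                       ∎)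
  where
  open ≡mod-Reasoning m
  regroup : ∀ x y z → x + (y + z) ≡ (x + z) + y
  regroup = solve-∀

≡mod-≤⇒multiple : ∀ {m σ J} → σ ≡ J mod m → σ ≤ J → ∃ λ Q → σ + Q * m ≡ J
≡mod-≤⇒multiple {m} {σ} {J} c le = quotient (≡0⇒∣ gap≡0)
  where
  gap≡0 : J ∸ σ ≡ 0 mod m
  gap≡0 = ≡mod-sym (≡mod-cancelˡ σ (≡mod-trans (≡⇒≡mod (+-identityʳ σ))
            (≡mod-trans c (≡⇒≡mod (sym (m+[n∸m]≡n le))))))
  quotient : m ∣ J ∸ σ → ∃ λ Q → σ + Q * m ≡ J
  quotient (divides Q gap≡Qm) = Q , trans (cong (σ +_) (sym gap≡Qm)) (m+[n∸m]≡n le)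

module _ {p} (p-prime : Prime p) {t : ℕ} (p∤t : ¬ p ∣ t) where

  private
    cancel-≤ : ∀ {x y} → x ≤ y → t * x ≡ t * y mod p → x ≡ y mod p
    cancel-≤ {x} x≤y c with d , refl ← m≤n⇒∃[o]m+o≡n x≤y = ≡mod-sym (begin
      x + d   ≈⟨ ≡mod-+ (≡mod-refl x) (∣⇒≡0 (p∣d (euclidsLemma t d p-prime (≡0⇒∣ td≡0)))) ⟩
      x + 0   ≡⟨ +-identityʳ x ⟩
      x       ∎)
      where
      open ≡mod-Reasoning p
      td≡0 : t * d ≡ 0 mod p
      td≡0 = ≡mod-sym (≡mod-cancelˡ (t * x) (begin
        t * x + 0       ≡⟨ +-identityʳ (t * x) ⟩
        t * x           ≈⟨ c ⟩
        t * (x + d)     ≡⟨ *-distribˡ-+ t x d ⟩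
        t * x + t * d   ∎))
      p∣d : (p ∣ t) ⊎ (p ∣ d) → p ∣ d
      p∣d (inj₁ p∣t) = ⊥-elim (p∤t p∣t)
      p∣d (inj₂ p∣d) = p∣d

  cancel-factor : ∀ {x y} → t * x ≡ t * y mod p → x ≡ y mod p
  cancel-factor {x} {y} c with ≤-total x y
  ... | inj₁ x≤y = cancel-≤ x≤y c
  ... | inj₂ y≤x = ≡mod-sym (cancel-≤ y≤x (≡mod-sym c))

inverse : ∀ {p} → Prime p → ∀ g .{{_ : NonZero g}} → g < p → ∃ λ w → w * g ≡ 1 mod p
inverse {p} p-prime g g<p = from-Bézout (coprime-Bézout (prime⇒coprime p-prime g<p))
  where
  from-Bézout : Bézout.Identity 1 p g → ∃ λ w → w * g ≡ 1 mod p
  from-Bézout (Bézout.-+ x y 1+xp≡yg) = y , balance 0 x (trans (+-identityʳ (y * g)) (sym 1+xp≡yg))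
  from-Bézout (Bézout.+- x y 1+yg≡xp) = (p ∸ 1) * y , ≡mod-cancelˡ (p ∸ 1) (begin
    p ∸ 1 + (p ∸ 1) * y * g   ≡⟨ factor (p ∸ 1) y g ⟩
    (p ∸ 1) * (y * g + 1)     ≈⟨ ≡mod-*ˡ (p ∸ 1) yg+1≡0 ⟩
    (p ∸ 1) * 0               ≡⟨ *-zeroʳ (p ∸ 1) ⟩
    0                         ≈⟨ multiple≡0 1 ⟨
    1 * p                     ≡⟨ *-identityˡ p ⟩
    p                         ≡⟨ m∸n+n≡m (≤-trans (s≤s z≤n) g<p) ⟨
    p ∸ 1 + 1                 ∎)
    where
    open ≡mod-Reasoning p
    factor : ∀ a y g → a + a * y * g ≡ a * (y * g + 1)
    factor = solve-∀
    yg+1≡0 : y * g + 1 ≡ 0 mod p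
    yg+1≡0 = balance 0 x (trans (+-identityʳ _) (trans (+-comm (y * g) 1) 1+yg≡xp))

¬∣-below : ∀ {p z} → 1 ≤ z → z < p → ¬ p ∣ z
¬∣-below {z = suc z} _ z<p p∣z = <⇒≱ z<p (∣⇒≤ p∣z)

∣-below⇒≡0 : ∀ {p x} → p ∣ x → x < p → x ≡ 0
∣-below⇒≡0 {x = zero} _ _ = refl
∣-below⇒≡0 {x = suc x} p∣x x<p = ⊥-elim (¬∣-below (s≤s z≤n) x<p p∣x)

∣⇒≤-positive : ∀ {p y} → p ∣ y → 1 ≤ y → p ≤ y
∣⇒≤-positive {y = suc _} p∣y _ = ∣⇒≤ p∣y

multiple-above : ∀ p .{{_ : NonZero p}} x → ∃ λ J → p ∣ J × x < J × J ≤ x + p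
multiple-above p x = x / p * p + p , divides (x / p + 1) (next-multiple (x / p) p) , x<J , J≤x+p
  where
  next-multiple : ∀ a p → a * p + p ≡ (a + 1) * p
  next-multiple = solve-∀
  x<J : x < x / p * p + p
  x<J = begin-strict
    x                    ≡⟨ m≡m%n+[m/n]*n x p ⟩
    x % p + x / p * p    <⟨ +-monoˡ-< (x / p * p) (m%n<n x p) ⟩
    p + x / p * p        ≡⟨ +-comm p _ ⟩
    x / p * p + p        ∎
    where open ≤-Reasoning
  J≤x+p : x / p * p + p ≤ x + p
  J≤x+p = +-monoˡ-≤ p (m/n*n≤m x p)

^-distribʳ-* : ∀ a b n → (a * b) ^ n ≡ a ^ n * b ^ n
^-distribʳ-* a b zero = refl
^-distribʳ-* a b (suc n) = trans (cong (a * b *_) (^-distribʳ-* a b n)) (interchange a b (a ^ n) (b ^ n))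
  where
  interchange : ∀ a b x y → a * b * (x * y) ≡ a * x * (b * y)
  interchange = solve-∀

m≤m^n : ∀ m n → 1 ≤ n → m ≤ m ^ n
m≤m^n zero (suc n) _ = z≤n
m≤m^n m@(suc _) (suc n) _ = subst (_≤ m * m ^ n) (*-identityʳ m) (*-monoʳ-≤ m (m^n>0 m n))

m*m≤m^n : ∀ m n → 2 ≤ n → m * m ≤ m ^ n
m*m≤m^n m (suc n) (s≤s 1≤n) = *-monoʳ-≤ m (m≤m^n m n 1≤n)

integer-root : ∀ p n → 1 < p → 1 ≤ n → ∃ λ L → L ^ n < p × p ≤ suc L ^ n
integer-root p n 1<p 1≤n = search (p ∸ 1) 1 (m+[n∸m]≡n (<⇒≤ 1<p)) (subst (_< p) (sym (^-zeroˡ n)) 1<p)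
  where
  search : ∀ d k → k + d ≡ p → k ^ n < p → ∃ λ L → L ^ n < p × p ≤ suc L ^ n
  search zero k k≡p kⁿ<p = k , kⁿ<p ,
    ≤-trans (subst (_≤ suc k) (trans (sym (+-identityʳ k)) k≡p) (n≤1+n k)) (m≤m^n (suc k) n 1≤n)
  search (suc d) k k+d≡p kⁿ<p = next (suc k ^ n <? p)
    where
    next : Dec (suc k ^ n < p) → ∃ λ L → L ^ n < p × p ≤ suc L ^ n
    next (yes [k+1]ⁿ<p) = search d (suc k) (trans (sym (+-suc k d)) k+d≡p) [k+1]ⁿ<p
    next (no [k+1]ⁿ≮p) = k , kⁿ<p , ≮⇒≥ [k+1]ⁿ≮p

-- If X·λ < 3p and p ≤ λⁿ, then Xⁿ < 3ⁿ pⁿ⁻¹: raise to the n-th power,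
-- getting Xⁿ p ≤ (Xλ)ⁿ < 3ⁿ pⁿ, and cancel p.
small-criterion : ∀ X λ′ p n → 1 ≤ n → X * λ′ < 3 * p → p ≤ λ′ ^ n → X ^ n < 3 ^ n * p ^ (n ∸ 1)
small-criterion X λ′ p (suc k) _ X·λ<3p p≤λⁿ = *-cancelʳ-< p (X ^ suc k) (3 ^ suc k * p ^ k) (begin-strict
  X ^ suc k * p              ≤⟨ *-monoʳ-≤ (X ^ suc k) p≤λⁿ ⟩
  X ^ suc k * λ′ ^ suc k     ≡⟨ ^-distribʳ-* X λ′ (suc k) ⟨
  (X * λ′) ^ suc k           <⟨ ^-monoˡ-< (suc k) X·λ<3p ⟩
  (3 * p) ^ suc k            ≡⟨ ^-distribʳ-* 3 p (suc k) ⟩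
  3 ^ suc k * (p * p ^ k)    ≡⟨ rotate (3 ^ suc k) p (p ^ k) ⟩
  3 ^ suc k * p ^ k * p      ∎)
  where
  open ≤-Reasoning
  rotate : ∀ a b c → a * (b * c) ≡ a * c * b
  rotate = solve-∀

same-block : ∀ s .{{_ : NonZero s}} y₁ y₂ → y₁ ≤ y₂ → y₁ / s ≡ y₂ / s → y₂ < y₁ + s
same-block s y₁ y₂ le eq = begin-strict
  y₂                     ≡⟨ m≡m%n+[m/n]*n y₂ s ⟩
  y₂ % s + y₂ / s * s    <⟨ +-monoˡ-< (y₂ / s * s) (m%n<n y₂ s) ⟩
  s + y₂ / s * s         ≡⟨ cong (λ z → s + z * s) (sym eq) ⟩
  s + y₁ / s * s         ≤⟨ +-monoʳ-≤ s (m/n*n≤m y₁ s) ⟩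
  s + y₁                 ≡⟨ +-comm s y₁ ⟩
  y₁ + s                 ∎
  where open ≤-Reasoning

mixed-inequality : ∀ L q p h → 2 ≤ L → L * q < p → h ≤ q + q → (h ∸ 1) * suc L < 3 * p
mixed-inequality L q p h 2≤L Lq<p h≤2q = begin-strict
  (h ∸ 1) * suc L            ≤⟨ *-monoˡ-≤ (suc L) (≤-trans (m∸n≤m h 1) h≤2q) ⟩
  (q + q) * suc L            ≡⟨ expand q L ⟩
  L * q + (L * q + 2 * q)    ≤⟨ +-monoʳ-≤ (L * q) (+-monoʳ-≤ (L * q) (*-monoˡ-≤ q 2≤L)) ⟩
  L * q + (L * q + L * q)    <⟨ +-mono-<-≤ Lq<p (+-mono-≤ (<⇒≤ Lq<p) (<⇒≤ Lq<p)) ⟩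
  p + (p + p)                ≡⟨ triple p ⟩
  3 * p                      ∎
  where
  open ≤-Reasoning
  expand : ∀ q L → (q + q) * suc L ≡ L * q + (L * q + 2 * q)
  expand = solve-∀
  triple : ∀ p → p + (p + p) ≡ 3 * p
  triple = solve-∀

-- Writing M = L + 1 + d, the
-- key estimate is 2M² ≤ (d+3)p, which follows from 2M ≤ L(d+3).
large-maximum-inequality : ∀ L M p h → 2 ≤ L → L < M → L * suc M ≤ p →
                           suc M * h ≤ 2 * (M * M) + p → 1 ≤ h → (h ∸ 1) * suc L < 3 * p
large-maximum-inequality L M p h 2≤L L<M L[M+1]≤p bound 1≤h = begin-strict
  (h ∸ 1) * suc L             <⟨ m<m+n ((h ∸ 1) * suc L) (s≤s z≤n) ⟩
  (h ∸ 1) * suc L + suc L     ≡⟨ +-comm _ (suc L) ⟩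
  suc (h ∸ 1) * suc L         ≡⟨ cong (_* suc L) (m+[n∸m]≡n 1≤h) ⟩
  h * suc L                   ≡⟨ *-comm h (suc L) ⟩
  suc L * h                   ≤⟨ [L+1]h≤3p ⟩
  3 * p                       ∎
  where
  open ≤-Reasoning
  d : ℕ
  d = proj₁ (m≤n⇒∃[o]m+o≡n L<M)
  M≡ : suc L + d ≡ M
  M≡ = proj₂ (m≤n⇒∃[o]m+o≡n L<M)
  LM≤p : L * M ≤ p
  LM≤p = ≤-trans (*-monoʳ-≤ L (n≤1+n M)) L[M+1]≤p
  2M≤L[d+3] : 2 * M ≤ L * (d + 3)
  2M≤L[d+3] = subst (λ M → 2 * M ≤ L * (d + 3)) M≡ (twice L 2≤L)
    where
    twice : ∀ L → 2 ≤ L → 2 * (suc L + d) ≤ L * (d + 3)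
    twice L 2≤L with L′ , refl ← m≤n⇒∃[o]m+o≡n 2≤L =
      subst₂ _≤_ (sym (lhs L′ d)) (sym (rhs L′ d)) (m≤m+n (6 + 2 * L′ + 2 * d) (L′ * d + L′))
      where
      lhs : ∀ L′ d → 2 * (suc (2 + L′) + d) ≡ 6 + 2 * L′ + 2 * d
      lhs = solve-∀
      rhs : ∀ L′ d → (2 + L′) * (d + 3) ≡ 6 + 2 * L′ + 2 * d + (L′ * d + L′)
      rhs = solve-∀
  2M²≤p[d+3] : 2 * (M * M) ≤ p * (d + 3)
  2M²≤p[d+3] = *-cancelˡ-≤ L {{>-nonZero (≤-trans (s≤s z≤n) 2≤L)}} (begin
    L * (2 * (M * M))     ≡⟨ regroup L M ⟩
    (2 * M) * (L * M)     ≤⟨ *-monoʳ-≤ (2 * M) LM≤p ⟩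
    (2 * M) * p           ≤⟨ *-monoˡ-≤ p 2M≤L[d+3] ⟩
    L * (d + 3) * p       ≡⟨ rotate L (d + 3) p ⟩
    L * (p * (d + 3))     ∎)
    where
    regroup : ∀ a b → a * (2 * (b * b)) ≡ (2 * b) * (a * b)
    regroup = solve-∀
    rotate : ∀ a b c → a * b * c ≡ a * (c * b)
    rotate = solve-∀
  [L+1][2M²+p]≤3p[M+1] : suc L * (2 * (M * M) + p) ≤ 3 * p * suc M
  [L+1][2M²+p]≤3p[M+1] = begin
    suc L * (2 * (M * M) + p)                        ≡⟨ expand L M p ⟩
    (2 * M) * (L * M) + (2 * (M * M) + suc L * p)    ≤⟨ +-mono-≤ (*-monoʳ-≤ (2 * M) LM≤p) (+-monoˡ-≤ (suc L * p) 2M²≤p[d+3]) ⟩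
    (2 * M) * p + (p * (d + 3) + suc L * p)          ≡⟨ subst (λ M → (2 * M) * p + (p * (d + 3) + suc L * p) ≡ 3 * p * suc M) M≡ (collect L d p) ⟩
    3 * p * suc M                                    ∎
    where
    expand : ∀ a b p → suc a * (2 * (b * b) + p) ≡ (2 * b) * (a * b) + (2 * (b * b) + suc a * p)
    expand = solve-∀
    collect : ∀ L d p → (2 * (suc L + d)) * p + (p * (d + 3) + suc L * p) ≡ 3 * p * suc (suc L + d)
    collect = solve-∀
  [L+1]h≤3p : suc L * h ≤ 3 * p
  [L+1]h≤3p = *-cancelˡ-≤ (suc M) (begin
    suc M * (suc L * h)          ≡⟨ swap (suc M) (suc L) h ⟩
    suc L * (suc M * h)          ≤⟨ *-monoʳ-≤ (suc L) bound ⟩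
    suc L * (2 * (M * M) + p)    ≤⟨ [L+1][2M²+p]≤3p[M+1] ⟩
    3 * p * suc M                ≡⟨ *-comm (3 * p) (suc M) ⟩
    suc M * (3 * p)              ∎)
    where
    swap : ∀ a b c → a * (b * c) ≡ b * (a * c)
    swap = solve-∀

module _ {X : Set} where

  sumBy : (X → ℕ) → List X → ℕ
  sumBy c [] = 0
  sumBy c (x ∷ l) = c x + sumBy c l

  sumBy-++ : ∀ c l₁ l₂ → sumBy c (l₁ ++ l₂) ≡ sumBy c l₁ + sumBy c l₂
  sumBy-++ c [] l₂ = refl
  sumBy-++ c (x ∷ l₁) l₂ = trans (cong (c x +_) (sumBy-++ c l₁ l₂)) (sym (+-assoc (c x) _ _))

  sumBy-replicate : ∀ c k x → sumBy c (replicate k x) ≡ k * c x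
  sumBy-replicate c zero x = refl
  sumBy-replicate c (suc k) x = cong (c x +_) (sumBy-replicate c k x)

  sumBy-const : ∀ c k {l} → All (λ x → c x ≡ k) l → sumBy c l ≡ length l * k
  sumBy-const c k [] = refl
  sumBy-const c k (cx≡k ∷ all) = cong₂ _+_ cx≡k (sumBy-const c k all)

  sumBy-≤ : ∀ c m {l} → All (λ x → c x ≤ m) l → sumBy c l ≤ length l * m
  sumBy-≤ c m [] = z≤n
  sumBy-≤ c m (cx≤m ∷ all) = +-mono-≤ cx≤m (sumBy-≤ c m all)

  length≤sumBy : ∀ c {l} → All (λ x → 1 ≤ c x) l → length l ≤ sumBy c l
  length≤sumBy c [] = z≤n
  length≤sumBy c (1≤cx ∷ all) = +-mono-≤ 1≤cx (length≤sumBy c all)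

  sumBy-positive⇒nonempty : ∀ c l → 1 ≤ sumBy c l → 1 ≤ length l
  sumBy-positive⇒nonempty c (x ∷ l) _ = s≤s z≤n

  sumBy-scale : ∀ {m} (c d : X → ℕ) T {P : X → Set} → (∀ {x} → P x → T * d x ≡ c x mod m) →
                ∀ {l} → All P l → T * sumBy d l ≡ sumBy c l mod m
  sumBy-scale c d T termwise [] = ≡⇒≡mod (*-zeroʳ T)
  sumBy-scale c d T termwise {x ∷ l} (px ∷ all) =
    ≡mod-trans (≡⇒≡mod (*-distribˡ-+ T (d x) _)) (≡mod-+ (termwise px) (sumBy-scale c d T termwise all))

  prefix-residue : (c : X → ℕ) (M : ℕ) → List X → Fin (suc (suc M)) → Fin (suc M)
  prefix-residue c M l i = fromℕ< (m%n<n (sumBy c (List.take (toℕ i) l)) (suc M))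

  -- Pigeonhole on the M+2 prefix sums of a list of length > M: two agree
  -- modulo M+1, and deleting the block between them keeps the sum's residue.
  shorten-once : ∀ (c : X → ℕ) {P : X → Set} M (l : List X) → M < length l → All P l →
                 ∃ λ l′ → All P l′ × length l′ < length l × sumBy c l′ ≡ sumBy c l mod suc M
  shorten-once c M l M<len all
    with i , j , i<j , same ← Finₚ.pigeonhole (n<1+n (suc M)) (prefix-residue c M l) =
    List.take a l ++ List.drop b l , Allₚ.++⁺ (Allₚ.take⁺ a all) (Allₚ.drop⁺ b all) , shorter , congruent
    where
    a b : ℕ
    a = toℕ i
    b = toℕ j
    b≤len : b ≤ length l
    b≤len = ≤-trans (s≤s⁻¹ (Finₚ.toℕ<n j)) M<len
    shorter : length (List.take a l ++ List.drop b l) < length l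
    shorter = begin-strict
      length (List.take a l ++ List.drop b l)        ≡⟨ length-++ (List.take a l) ⟩
      length (List.take a l) + length (List.drop b l)
        ≡⟨ cong₂ _+_ (trans (length-take a l) (m≤n⇒m⊓n≡m (≤-trans (<⇒≤ i<j) b≤len))) (length-drop b l) ⟩
      a + (length l ∸ b)                             <⟨ +-monoˡ-< (length l ∸ b) i<j ⟩
      b + (length l ∸ b)                             ≡⟨ m+[n∸m]≡n b≤len ⟩
      length l                                       ∎
      where open ≤-Reasoning
    same-prefix : sumBy c (List.take a l) ≡ sumBy c (List.take b l) mod suc M
    same-prefix = %≡⇒≡mod (trans (sym (Finₚ.toℕ-fromℕ< _)) (trans (cong toℕ same) (Finₚ.toℕ-fromℕ< _)))
    congruent : sumBy c (List.take a l ++ List.drop b l) ≡ sumBy c l mod suc M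
    congruent = begin
      sumBy c (List.take a l ++ List.drop b l)                ≡⟨ sumBy-++ c (List.take a l) (List.drop b l) ⟩
      sumBy c (List.take a l) + sumBy c (List.drop b l)       ≈⟨ ≡mod-+ same-prefix (≡mod-refl _) ⟩
      sumBy c (List.take b l) + sumBy c (List.drop b l)       ≡⟨ sumBy-++ c (List.take b l) (List.drop b l) ⟨
      sumBy c (List.take b l ++ List.drop b l)                ≡⟨ cong (sumBy c) (take++drop≡id b l) ⟩
      sumBy c l                                               ∎
      where open ≡mod-Reasoning (suc M)

  Shortening : (c : X → ℕ) (P : X → Set) (M : ℕ) → List X → Set
  Shortening c P M l = ∃ λ l′ → All P l′ × length l′ ≤ M × sumBy c l′ ≡ sumBy c l mod suc M

  shorten : ∀ (c : X → ℕ) {P : X → Set} M (l : List X) → All P l → Shortening c P M l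
  shorten c {P} M l = go (length l) l ≤-refl
    where
    go : ∀ bound l → length l ≤ bound → All P l → Shortening c P M l
    iterate : ∀ bound l → length l ≤ bound → M < length l → All P l → Shortening c P M l
    go bound l len≤bound all with length l ≤? M
    ... | yes len≤M = l , all , len≤M , ≡mod-refl _
    ... | no len≰M = iterate bound l len≤bound (≰⇒> len≰M) all
    iterate zero l len≤0 M<len all = ⊥-elim (<⇒≱ M<len (≤-trans len≤0 z≤n))
    iterate (suc bound) l len≤bound M<len all = continue (shorten-once c M l M<len all)
      where
      continue : (∃ λ l₁ → All P l₁ × length l₁ < length l × sumBy c l₁ ≡ sumBy c l mod suc M) →
                 Shortening c P M l
      continue (l₁ , all₁ , shorter , c₁) = finish (go bound l₁ (s≤s⁻¹ (≤-trans shorter len≤bound)) all₁)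
        where
        finish : Shortening c P M l₁ → Shortening c P M l
        finish (l₂ , all₂ , len₂≤M , c₂) = l₂ , all₂ , len₂≤M , ≡mod-trans c₂ c₁

gcdFold : ∀ k → (Fin k → ℕ) → ℕ → ℕ
gcdFold zero f g = g
gcdFold (suc k) f g = gcdFold k (λ i → f (Fin.suc i)) (gcd g (f Fin.zero))

gcdFold∣init : ∀ k f g → gcdFold k f g ∣ g
gcdFold∣init zero f g = ∣-refl
gcdFold∣init (suc k) f g = ∣-trans (gcdFold∣init k _ _) (gcd[m,n]∣m g (f Fin.zero))

gcdFold∣entry : ∀ k f g i → gcdFold k f g ∣ f i
gcdFold∣entry (suc k) f g Fin.zero = ∣-trans (gcdFold∣init k _ _) (gcd[m,n]∣n g (f Fin.zero))
gcdFold∣entry (suc k) f g (Fin.suc i) = gcdFold∣entry k _ _ i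

module AdditiveClosure (M : ℕ) (R : ℕ → Set)
  (R-+ : ∀ {u v} → R u → R v → R (u + v))
  (R-≡ : ∀ {u v} → u ≡ v mod suc M → R u → R v) where

  Multiples : ℕ → Set
  Multiples a = ∀ z → R (z * a)

  -- A Bézout relation d + yb = xa gives z·d ≡ zx·a + zyM·b modulo M+1,
  -- because zy·b + zyM·b is a multiple of M+1.
  bézout-combination : ∀ {d a b x y} z → d + y * b ≡ x * a → z * x * a + z * y * M * b ≡ z * d mod suc M
  bézout-combination {d} {a} {b} {x} {y} z d+yb≡xa = balance 0 (z * y * b) (begin
    z * x * a + z * y * M * b + 0 * suc M   ≡⟨ drop-zero z x a y M b ⟩
    z * (x * a) + z * y * M * b             ≡⟨ cong (λ w → z * w + z * y * M * b) d+yb≡xa ⟨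
    z * (d + y * b) + z * y * M * b         ≡⟨ collect z d y b M ⟩
    z * d + z * y * b * suc M               ∎)
    where
    open ≡-Reasoning
    drop-zero : ∀ z x a y M b → z * x * a + z * y * M * b + 0 * suc M ≡ z * (x * a) + z * y * M * b
    drop-zero = solve-∀
    collect : ∀ z d y b M → z * (d + y * b) + z * y * M * b ≡ z * d + z * y * b * suc M
    collect = solve-∀

  gcd-multiples : ∀ a b → Multiples a → Multiples b → Multiples (gcd a b)
  gcd-multiples a b Ra Rb z with Bézout.identity (gcd-GCD a b)
  ... | Bézout.+- x y d+yb≡xa = R-≡ (bézout-combination z d+yb≡xa) (R-+ (Ra (z * x)) (Rb (z * y * M)))
  ... | Bézout.-+ x y d+xa≡yb = R-≡ (bézout-combination z d+xa≡yb) (R-+ (Rb (z * y)) (Ra (z * x * M)))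

  multiples-gcdFold : ∀ k f g → Multiples g → (∀ i → Multiples (f i)) → Multiples (gcdFold k f g)
  multiples-gcdFold zero f g Rg Rf = Rg
  multiples-gcdFold (suc k) f g Rg Rf =
    multiples-gcdFold k _ _ (gcd-multiples g (f Fin.zero) Rg (Rf Fin.zero)) (λ i → Rf (Fin.suc i))

some-or-all : ∀ {k} {P Q : Fin k → Set} → (∀ i → P i ⊎ Q i) → (∃ P) ⊎ (∀ i → Q i)
some-or-all {zero} choice = inj₂ (λ ())
some-or-all {suc k} choice with choice Fin.zero | some-or-all (λ i → choice (Fin.suc i))
... | inj₁ P0 | _ = inj₁ (Fin.zero , P0)
... | inj₂ Q0 | inj₁ (i , Pi) = inj₁ (Fin.suc i , Pi)
... | inj₂ Q0 | inj₂ allQ = inj₂ λ { Fin.zero → Q0 ; (Fin.suc i) → allQ i }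

uniform-or-mixed : ∀ {k} {P Q : Fin k → Set} → (∀ i → P i ⊎ Q i) →
                   (∀ i → P i) ⊎ (∀ i → Q i) ⊎ (∃ P × ∃ Q)
uniform-or-mixed choice with some-or-all choice
... | inj₂ allQ = inj₂ (inj₁ allQ)
... | inj₁ someP with some-or-all (λ i → Data.Sum.swap (choice i))
...   | inj₂ allP = inj₁ allP
...   | inj₁ someQ = inj₂ (inj₂ (someP , someQ))

argmax : ∀ {k} → 1 ≤ k → (f : Fin k → ℕ) → ∃ λ i → ∀ j → f j ≤ f i
argmax {suc zero} _ f = Fin.zero , λ { Fin.zero → ≤-refl }
argmax {suc (suc k)} _ f with argmax (s≤s z≤n) (λ i → f (Fin.suc i))
... | i , rest≤ with f Fin.zero ≤? f (Fin.suc i)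
...   | yes f0≤ = Fin.suc i , λ { Fin.zero → f0≤ ; (Fin.suc j) → rest≤ j }
...   | no f0≰ = Fin.zero , λ { Fin.zero → ≤-refl ; (Fin.suc j) → ≤-trans (rest≤ j) (<⇒≤ (≰⇒> f0≰)) }

module ZeroSums {p : ℕ} (A : Subset p) where

  weight : List (Fin p) → ℕ
  weight = sumBy toℕ

  ZeroSum : List (Fin p) → Set
  ZeroSum l = All (_∈ A) l × p ∣ weight l

  zeroSum⇒0∈kA : ∀ l → ZeroSum l → ZeroInSumset p A (length l)
  zeroSum⇒0∈kA l (l⊆A , p∣Σ) = List.lookup l , members l l⊆A , subst (p ∣_) (sym (sum-lookup l)) p∣Σ
    where
    members : ∀ l → All (_∈ A) l → ∀ i → List.lookup l i ∈ A
    members (x ∷ l) (x∈A ∷ l⊆A) Fin.zero = x∈A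
    members (x ∷ l) (x∈A ∷ l⊆A) (Fin.suc i) = members l l⊆A i
    sum-lookup : ∀ l → Vec.sum (Vec.tabulate (λ i → toℕ (List.lookup l i))) ≡ weight l
    sum-lookup [] = refl
    sum-lookup (x ∷ l) = cong (toℕ x +_) (sum-lookup l)

  0∈kA⇒zeroSum : ∀ {k} → ZeroInSumset p A k → ∃ λ l → length l ≡ k × ZeroSum l
  0∈kA⇒zeroSum {k} (x , x∈A , p∣Σ) =
    List.tabulate x , length-tabulate x , (members k x x∈A , subst (p ∣_) (sum-tabulate k x) p∣Σ)
    where
    members : ∀ k (x : Fin k → Fin p) → (∀ i → x i ∈ A) → All (_∈ A) (List.tabulate x)
    members zero x x∈A = []
    members (suc k) x x∈A = x∈A Fin.zero ∷ members k (λ i → x (Fin.suc i)) (λ i → x∈A (Fin.suc i))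
    sum-tabulate : ∀ k (x : Fin k → Fin p) → Vec.sum (Vec.tabulate (λ i → toℕ (x i))) ≡ weight (List.tabulate x)
    sum-tabulate zero x = refl
    sum-tabulate (suc k) x = cong (toℕ (x Fin.zero) +_) (sum-tabulate k (λ i → x (Fin.suc i)))

  coheight-minimal : ∀ {h} → IsCoheight p A h → ∀ l → ZeroSum l → 1 ≤ length l → h ≤ length l
  coheight-minimal {h} (_ , _ , below-h) l zs 1≤len with h ≤? length l
  ... | yes h≤len = h≤len
  ... | no h≰len = ⊥-elim (below-h (length l) 1≤len (≰⇒> h≰len) (zeroSum⇒0∈kA l zs))

  coheight-witness : ∀ {h} → IsCoheight p A h → ∃ λ l → length l ≡ h × ZeroSum l
  coheight-witness (_ , 0∈hA , _) = 0∈kA⇒zeroSum 0∈hA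

record Enumeration {p : ℕ} (A : Subset p) (n : ℕ) : Set where
  field
    elem : Fin n → Fin p
    injective : ∀ {i j} → elem i ≡ elem j → i ≡ j
    member : ∀ i → elem i ∈ A
    index : ∀ {x} → x ∈ A → Fin n
    elem-index : ∀ {x} (x∈A : x ∈ A) → elem (index x∈A) ≡ x

enumerate : ∀ {p} (A : Subset p) → Enumeration A ∣ A ∣
enumerate Vec.[] = record
  { elem = λ () ; injective = λ {} ; member = λ () ; index = λ () ; elem-index = λ () }
enumerate (outside ∷ A) = record
  { elem = λ i → Fin.suc (elem i)
  ; injective = λ eq → injective (Finₚ.suc-injective eq)
  ; member = λ i → there (member i)
  ; index = λ { (there x∈A) → index x∈A }
  ; elem-index = λ { (there x∈A) → cong Fin.suc (elem-index x∈A) } }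
  where open Enumeration (enumerate A)
enumerate (inside ∷ A) = record
  { elem = elem′ ; injective = injective′ ; member = member′ ; index = index′ ; elem-index = elem-index′ }
  where
  open Enumeration (enumerate A)
  elem′ : Fin (suc ∣ A ∣) → Fin _
  elem′ Fin.zero = Fin.zero
  elem′ (Fin.suc i) = Fin.suc (elem i)
  injective′ : ∀ {i j} → elem′ i ≡ elem′ j → i ≡ j
  injective′ {Fin.zero} {Fin.zero} eq = refl
  injective′ {Fin.suc i} {Fin.suc j} eq = cong Fin.suc (injective (Finₚ.suc-injective eq))
  member′ : ∀ i → elem′ i ∈ (inside ∷ A)
  member′ Fin.zero = here
  member′ (Fin.suc i) = there (member i)
  index′ : ∀ {x} → x ∈ (inside ∷ A) → Fin (suc ∣ A ∣)
  index′ here = Fin.zero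
  index′ (there x∈A) = Fin.suc (index x∈A)
  elem-index′ : ∀ {x} (x∈A : x ∈ (inside ∷ A)) → elem′ (index′ x∈A) ≡ x
  elem-index′ here = refl
  elem-index′ (there x∈A) = cong Fin.suc (elem-index x∈A)

SmallCoheight : (p n h : ℕ) → Set
SmallCoheight p n h = (0 < h) × ((h ∸ 1) ^ n < (3 ^ n) * (p ^ (n ∸ 1)))

BlockCoheight : (p n h : ℕ) → Set
BlockCoheight p n h = ∃ λ (b : ℕ) → (n ≤ b) × ((b ∸ 1) ^ n < p) × (p ≤ b * h) × (b * h < p + b * b)

module CoheightBound {p : ℕ} (p-prime : Prime p) {A : Subset p} {n : ℕ}
                     (enum : Enumeration A n) (1≤n : 1 ≤ n)
                     {h : ℕ} (coheight : IsCoheight p A h) where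

  open Enumeration enum
  open ZeroSums A

  Conclusion : Set
  Conclusion = SmallCoheight p n h ⊎ BlockCoheight p n h

  instance
    p-nonZero : NonZero p
    p-nonZero = prime⇒nonZero p-prime

  1<p : 1 < p
  1<p = nonTrivial⇒n>1 p {{prime⇒nonTrivial p-prime}}

  1≤p : 1 ≤ p
  1≤p = <⇒≤ 1<p

  1≤h : 1 ≤ h
  1≤h = proj₁ coheight

  small : ∀ λ′ → (h ∸ 1) * λ′ < 3 * p → p ≤ λ′ ^ n → Conclusion
  small λ′ bound p≤λⁿ = inj₁ (1≤h , small-criterion (h ∸ 1) λ′ p n 1≤n bound p≤λⁿ)

  -- Repeating one element p times gives a zero sum, so h ≤ p.
  h≤p : h ≤ p
  h≤p = subst (h ≤_) (length-replicate p)
          (coheight-minimal coheight (replicate p a) (Allₚ.replicate⁺ p (member i₀) , p∣Σ)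
                            (subst (1 ≤_) (sym (length-replicate p)) 1≤p))
    where
    i₀ : Fin n
    i₀ = fromℕ< 1≤n
    a : Fin p
    a = elem i₀
    p∣Σ : p ∣ weight (replicate p a)
    p∣Σ = subst (p ∣_) (sym (sumBy-replicate toℕ p a)) (m∣m*n (toℕ a))

  -- If p ≤ λⁿ for some λ ≤ 2, then h ≤ p already gives the first alternative.
  small-root : ∀ λ′ → λ′ ≤ 2 → p ≤ λ′ ^ n → Conclusion
  small-root λ′ λ≤2 p≤λⁿ = small λ′ (begin-strict
    (h ∸ 1) * λ′   ≤⟨ *-mono-≤ (≤-trans (m∸n≤m h 1) h≤p) λ≤2 ⟩
    p * 2          <⟨ *-monoʳ-< p (n<1+n 2) ⟩
    p * 3          ≡⟨ *-comm p 3 ⟩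
    3 * p          ∎) p≤λⁿ
    where open ≤-Reasoning

  0ₚ : Fin p
  0ₚ = fromℕ< 1≤p

  -- If 0 ∈ A then h = 1, and λ = p shows the first alternative.
  zero-member : 0ₚ ∈ A → Conclusion
  zero-member 0∈A = small p (subst (λ x → x * p < 3 * p) (sym (m≤n⇒m∸n≡0 h≤1)) 0<3p) (m≤m^n p n 1≤n)
    where
    0<3p : 0 < 3 * p
    0<3p = ≤-trans 1≤p (m≤m+n p _)
    p∣0ₚ : p ∣ weight (0ₚ ∷ [])
    p∣0ₚ = subst (p ∣_) (sym (trans (+-identityʳ (toℕ 0ₚ)) (Finₚ.toℕ-fromℕ< 1≤p))) (p ∣0)
    h≤1 : h ≤ 1
    h≤1 = coheight-minimal coheight (0ₚ ∷ []) (0∈A ∷ [] , p∣0ₚ) (s≤s z≤n)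

  module WithoutZero (0∉A : 0ₚ ∉ A) where

    ¬∣-member : ∀ {x} → x ∈ A → ¬ (p ∣ toℕ x)
    ¬∣-member {x} x∈A p∣x = 0∉A (subst (_∈ A) x≡0ₚ x∈A)
      where
      x≡0ₚ : x ≡ 0ₚ
      x≡0ₚ = Finₚ.toℕ-injective (trans (∣-below⇒≡0 p∣x (Finₚ.toℕ<n x)) (sym (Finₚ.toℕ-fromℕ< 1≤p)))

    ¬≡0-multiple : ∀ {t x} → ¬ (p ∣ t) → x ∈ A → ¬ (t * toℕ x ≡ 0 mod p)
    ¬≡0-multiple {t} {x} p∤t x∈A tx≡0 with euclidsLemma t (toℕ x) p-prime (≡0⇒∣ tx≡0)
    ... | inj₁ p∣t = p∤t p∣t
    ... | inj₂ p∣x = ¬∣-member x∈A p∣x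

    -- If n = 1, every zero sum is h·a ≡ 0 for the single element a, so p ∣ h,
    -- hence h = p and b = 1 gives the second alternative.
    singleton : n ≡ 1 → Conclusion
    singleton refl with l , len≡h , l⊆A , p∣Σ ← coheight-witness coheight =
      inj₂ (1 , ≤-refl , 1≤p , subst (p ≤_) (sym (*-identityˡ h)) p≤h ,
            subst (_< p + 1) (sym (*-identityˡ h)) (subst (h <_) (+-comm 1 p) (s≤s h≤p)))
      where
      a : Fin p
      a = elem Fin.zero
      all-a : All (λ x → toℕ x ≡ toℕ a) l
      all-a = All.map (λ x∈A → cong toℕ (trans (sym (elem-index x∈A)) (cong elem (single (index x∈A))))) l⊆A
        where
        single : (i : Fin 1) → i ≡ Fin.zero
        single Fin.zero = refl
      p∣ha : p ∣ h * toℕ a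
      p∣ha = subst (p ∣_) (trans (sumBy-const toℕ (toℕ a) all-a) (cong (_* toℕ a) len≡h)) p∣Σ
      p≤h : p ≤ h
      p≤h with euclidsLemma h (toℕ a) p-prime p∣ha
      ... | inj₁ p∣h = ∣⇒≤-positive p∣h 1≤h
      ... | inj₂ p∣a = ⊥-elim (¬∣-member (member Fin.zero) p∣a)

  record Dilation : Set where
    field
      T M : ℕ
      c : Fin p → ℕ
      top : Fin p
      top∈A : top ∈ A
      c-top : c top ≡ suc M
      c-residue : ∀ {x} → x ∈ A → T * toℕ x ≡ c x mod p
      c-positive : ∀ {x} → x ∈ A → 1 ≤ c x
      c-bounded : ∀ {x} → x ∈ A → c x ≤ suc M
      M<p : suc M < p

  module DilationFacts (D : Dilation) where
    open Dilation D

    -- T is a unit modulo p, since T·top ≡ M+1 with 0 < M+1 < p.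
    p∤T : ¬ (p ∣ T)
    p∤T p∣T = ¬∣-below (s≤s z≤n) M<p (≡0⇒∣ (begin
      suc M          ≡⟨ c-top ⟨
      c top          ≈⟨ c-residue top∈A ⟨
      T * toℕ top    ≈⟨ ≡mod-* (∣⇒≡0 p∣T) (≡mod-refl (toℕ top)) ⟩
      0 * toℕ top    ∎))
      where open ≡mod-Reasoning p

    -- The residue sum of a list from A is T times its weight, so it
    -- detects zero sums (T being a unit modulo p).
    residue-sum : ∀ {l} → All (_∈ A) l → T * weight l ≡ sumBy c l mod p
    residue-sum = sumBy-scale c toℕ T c-residue

    zero-sum⇒p∣residues : ∀ {l} → ZeroSum l → p ∣ sumBy c l
    zero-sum⇒p∣residues {l} (l⊆A , p∣Σ) = ≡0⇒∣ (begin
      sumBy c l      ≈⟨ residue-sum l⊆A ⟨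
      T * weight l   ≈⟨ ≡mod-*ˡ T (∣⇒≡0 p∣Σ) ⟩
      T * 0          ≡⟨ *-zeroʳ T ⟩
      0              ∎)
      where open ≡mod-Reasoning p

    p∣residues⇒zero-sum : ∀ {l} → All (_∈ A) l → p ∣ sumBy c l → ZeroSum l
    p∣residues⇒zero-sum {l} l⊆A p∣Σc =
      l⊆A , cancel-T (euclidsLemma T (weight l) p-prime (≡0⇒∣ (≡mod-trans (residue-sum l⊆A) (∣⇒≡0 p∣Σc))))
      where
      cancel-T : (p ∣ T) ⊎ (p ∣ weight l) → p ∣ weight l
      cancel-T (inj₁ p∣T) = ⊥-elim (p∤T p∣T)
      cancel-T (inj₂ p∣Σ) = p∣Σ

    -- The h residues of a shortest zero sum add up to a positive multiple
    -- of p, and each is at most M+1.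
    coheight-lower : p ≤ suc M * h
    coheight-lower = from-witness (coheight-witness coheight)
      where
      from-witness : (∃ λ l → length l ≡ h × ZeroSum l) → p ≤ suc M * h
      from-witness (l , len≡h , zs) = begin
        p                    ≤⟨ ∣⇒≤-positive (zero-sum⇒p∣residues zs) (≤-trans 1≤h h≤Σc) ⟩
        sumBy c l            ≤⟨ sumBy-≤ c (suc M) (All.map c-bounded (proj₁ zs)) ⟩
        length l * suc M     ≡⟨ cong (_* suc M) len≡h ⟩
        h * suc M            ≡⟨ *-comm h (suc M) ⟩
        suc M * h            ∎
        where
        open ≤-Reasoning
        h≤Σc : h ≤ sumBy c l
        h≤Σc = subst (_≤ sumBy c l) len≡h (length≤sumBy c (All.map c-positive (proj₁ zs)))

    -- Distinct elements of A have distinct residues in [1, M+1], so n ≤ M+1.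
    n≤M+1 : n ≤ suc M
    n≤M+1 = Finₚ.injective⇒≤ slot-injective
      where
      slot : Fin n → Fin (suc M)
      slot k = fromℕ< (s≤s (∸-monoˡ-≤ 1 (c-bounded (member k))))
      slot-injective : ∀ {k k′} → slot k ≡ slot k′ → k ≡ k′
      slot-injective {k} {k′} eq = injective (Finₚ.toℕ-injective
        (≡mod⇒≡ (cancel-factor p-prime p∤T same-multiple) (Finₚ.toℕ<n (elem k)) (Finₚ.toℕ<n (elem k′))))
        where
        same-slot : c (elem k) ∸ 1 ≡ c (elem k′) ∸ 1
        same-slot = trans (sym (Finₚ.toℕ-fromℕ< _)) (trans (cong toℕ eq) (Finₚ.toℕ-fromℕ< _))
        same-residue : c (elem k) ≡ c (elem k′)
        same-residue = trans (sym (m+[n∸m]≡n (c-positive (member k))))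
                             (trans (cong suc same-slot) (m+[n∸m]≡n (c-positive (member k′))))
        same-multiple : T * toℕ (elem k) ≡ T * toℕ (elem k′) mod p
        same-multiple = ≡mod-trans (c-residue (member k))
                          (≡mod-trans (≡⇒≡mod same-residue) (≡mod-sym (c-residue (member k′))))

    Low : Fin p → Set
    Low x = x ∈ A × c x < suc M

    Representation : ℕ → Set
    Representation z = ∃ λ l → All Low l × sumBy c l ≡ z mod suc M

    -- The residues (together with M+1, which is one of them) are coprime.
    Primitive : Set
    Primitive = gcdFold n (λ k → c (elem k)) (suc M) ≡ 1

    -- Representations add up and only depend on z modulo M+1; every multiple
    -- of a residue is represented.  By Bézout, so is every multiple of the
    -- gcd of all residues: in the coprime case, every z.
    represent : Primitive → ∀ z → Representation z
    represent coprime z =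
      subst Representation (*-identityʳ z)
        (subst (λ g → Representation (z * g)) coprime
          (multiples-gcdFold n (λ k → c (elem k)) (suc M) top-multiples (λ k → residue-multiples (member k)) z))
      where
      combine : ∀ {u v} → Representation u → Representation v → Representation (u + v)
      combine (l₁ , low₁ , σ₁≡u) (l₂ , low₂ , σ₂≡v) =
        l₁ ++ l₂ , Allₚ.++⁺ low₁ low₂ , ≡mod-trans (≡⇒≡mod (sumBy-++ c l₁ l₂)) (≡mod-+ σ₁≡u σ₂≡v)
      transport : ∀ {u v} → u ≡ v mod suc M → Representation u → Representation v
      transport u≡v (l , low , σ≡u) = l , low , ≡mod-trans σ≡u u≡v
      open AdditiveClosure M Representation combine transport
      top-multiples : Multiples (suc M)
      top-multiples z = [] , [] , ≡mod-sym (multiple≡0 z)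
      residue-multiples : ∀ {x} → x ∈ A → Multiples (c x)
      residue-multiples {x} x∈A z with m≤n⇒m<n∨m≡n (c-bounded x∈A)
      ... | inj₁ cx<M+1 = replicate z x , Allₚ.replicate⁺ z (x∈A , cx<M+1) , ≡⇒≡mod (sumBy-replicate c z x)
      ... | inj₂ cx≡M+1 = subst (λ w → Representation (z * w)) (sym cx≡M+1) (top-multiples z)

    short-representation : Primitive → ∀ z →
                           ∃ λ l → All Low l × length l ≤ M × sumBy c l ≡ z mod suc M
    short-representation coprime z = shorten-representation (represent coprime z)
      where
      shorten-representation : Representation z →
                               ∃ λ l → All Low l × length l ≤ M × sumBy c l ≡ z mod suc M
      shorten-representation (l , low , σ≡z) = finish (shorten c M l low)
        where
        finish : Shortening c Low M l → ∃ λ l → All Low l × length l ≤ M × sumBy c l ≡ z mod suc M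
        finish (l′ , low′ , len≤M , σ′≡σ) = l′ , low′ , len≤M , ≡mod-trans σ′≡σ σ≡z

    short-sum≤M² : ∀ {l} → All Low l → length l ≤ M → sumBy c l ≤ M * M
    short-sum≤M² low r≤M = ≤-trans (sumBy-≤ c M (All.map (λ low → s≤s⁻¹ (proj₂ low)) low)) (*-monoˡ-≤ M r≤M)

    -- Completing a list l of low elements by Q copies of the top element to
    -- residue sum exactly J, a positive multiple of p, gives a zero sum of
    -- length Q + r; hence (M+1)h ≤ (M+1)(Q + r) ≤ J + Mr, using r ≤ σ.
    completion-bound : ∀ {l} J Q → 1 ≤ J → p ∣ J → All Low l → sumBy c l + Q * suc M ≡ J →
                       suc M * h ≤ J + M * length l
    completion-bound {l} J Q 1≤J p∣J low σ+Q[M+1]≡J = begin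
      suc M * h                  ≤⟨ *-monoʳ-≤ (suc M) h≤Q+r ⟩
      suc M * (Q + r)            ≡⟨ expand M Q r ⟩
      Q * suc M + (r + M * r)    ≤⟨ +-monoʳ-≤ (Q * suc M) (+-monoˡ-≤ (M * r) r≤σ) ⟩
      Q * suc M + (σ + M * r)    ≡⟨ regroup (Q * suc M) σ (M * r) ⟩
      (σ + Q * suc M) + M * r    ≡⟨ cong (_+ M * r) σ+Q[M+1]≡J ⟩
      J + M * r                  ∎
      where
      open ≤-Reasoning
      σ r : ℕ
      σ = sumBy c l
      r = length l
      Z : List (Fin p)
      Z = replicate Q top ++ l
      Z⊆A : All (_∈ A) Z
      Z⊆A = Allₚ.++⁺ (Allₚ.replicate⁺ Q top∈A) (All.map proj₁ low)
      ΣZ≡J : sumBy c Z ≡ J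
      ΣZ≡J = begin-equality
        sumBy c Z                          ≡⟨ sumBy-++ c (replicate Q top) l ⟩
        sumBy c (replicate Q top) + σ      ≡⟨ cong (_+ σ) (sumBy-replicate c Q top) ⟩
        Q * c top + σ                      ≡⟨ cong (λ w → Q * w + σ) c-top ⟩
        Q * suc M + σ                      ≡⟨ +-comm (Q * suc M) σ ⟩
        σ + Q * suc M                      ≡⟨ σ+Q[M+1]≡J ⟩
        J                                  ∎
      h≤Q+r : h ≤ Q + r
      h≤Q+r = subst (h ≤_) (trans (length-++ (replicate Q top)) (cong (_+ r) (length-replicate Q)))
        (coheight-minimal coheight Z (p∣residues⇒zero-sum Z⊆A (subst (p ∣_) (sym ΣZ≡J) p∣J))
          (sumBy-positive⇒nonempty c Z (subst (1 ≤_) (sym ΣZ≡J) 1≤J)))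
      r≤σ : r ≤ σ
      r≤σ = length≤sumBy c (All.map (λ low → c-positive (proj₁ low)) low)
      expand : ∀ M Q r → suc M * (Q + r) ≡ Q * suc M + (r + M * r)
      expand = solve-∀
      regroup : ∀ a b c → a + (b + c) ≡ (b + a) + c
      regroup = solve-∀

    -- Hence, in the primitive case, (M+1)h ≤ J + M² for every positive
    -- multiple J ≥ M² of p: complete a short representation of J.
    coheight-upper : Primitive → ∀ J → 1 ≤ J → p ∣ J → M * M ≤ J → suc M * h ≤ J + M * M
    coheight-upper coprime J 1≤J p∣J M²≤J = from-short (short-representation coprime J)
      where
      from-short : (∃ λ l → All Low l × length l ≤ M × sumBy c l ≡ J mod suc M) → suc M * h ≤ J + M * M
      from-short (l , low , r≤M , σ≡J) = complete (≡mod-≤⇒multiple σ≡J (≤-trans (short-sum≤M² low r≤M) M²≤J))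
        where
        complete : (∃ λ Q → sumBy c l + Q * suc M ≡ J) → suc M * h ≤ J + M * M
        complete (Q , σ+Q[M+1]≡J) =
          ≤-trans (completion-bound J Q 1≤J p∣J low σ+Q[M+1]≡J) (+-monoʳ-≤ J (*-monoʳ-≤ M r≤M))

    -- If Mⁿ < p, then b = M+1 witnesses the second alternative (take J = p).
    block-case : Primitive → 2 ≤ n → M ^ n < p → Conclusion
    block-case coprime 2≤n Mⁿ<p = inj₂ (suc M , n≤M+1 , Mⁿ<p , coheight-lower , upper)
      where
      M²<p : M * M < p
      M²<p = ≤-<-trans (m*m≤m^n M n 2≤n) Mⁿ<p
      upper : suc M * h < p + suc M * suc M
      upper = ≤-<-trans (coheight-upper coprime p 1≤p ∣-refl (<⇒≤ M²<p))
                        (+-monoʳ-< p (*-mono-< (n<1+n M) (n<1+n M)))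

    -- If p ≤ Mⁿ while Lⁿ < p and L(M+1) ≤ p, then L < M, and the least
    -- multiple J of p above M² gives (M+1)h ≤ 2M² + p: the first alternative.
    large-case : Primitive → ∀ L → 2 ≤ L → L ^ n < p → p ≤ suc L ^ n → L * suc M ≤ p → p ≤ M ^ n → Conclusion
    large-case coprime L 2≤L Lⁿ<p p≤[L+1]ⁿ L[M+1]≤p p≤Mⁿ =
      small (suc L) (large-maximum-inequality L M p h 2≤L L<M L[M+1]≤p [M+1]h≤2M²+p 1≤h) p≤[L+1]ⁿ
      where
      L<M : L < M
      L<M = ≰⇒> (λ M≤L → <⇒≱ (≤-<-trans (^-monoˡ-≤ n M≤L) Lⁿ<p) p≤Mⁿ)
      via-multiple : (∃ λ J → p ∣ J × M * M < J × J ≤ M * M + p) → suc M * h ≤ 2 * (M * M) + p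
      via-multiple (J , p∣J , M²<J , J≤M²+p) = begin
        suc M * h            ≤⟨ coheight-upper coprime J (≤-trans (s≤s z≤n) M²<J) p∣J (<⇒≤ M²<J) ⟩
        J + M * M            ≤⟨ +-monoˡ-≤ (M * M) J≤M²+p ⟩
        (M * M + p) + M * M  ≡⟨ collect (M * M) p ⟩
        2 * (M * M) + p      ∎
        where
        open ≤-Reasoning
        collect : ∀ a b → (a + b) + a ≡ 2 * a + b
        collect = solve-∀
      [M+1]h≤2M²+p : suc M * h ≤ 2 * (M * M) + p
      [M+1]h≤2M²+p = via-multiple (multiple-above p (M * M))

  -- If the residues have a common divisor G > 1, dividing them by G (and T
  -- by G modulo p) gives a dilation with a smaller maximum.
  divide-out : (D : Dilation) → ¬ DilationFacts.Primitive D → ∃ λ D′ → Dilation.M D′ < Dilation.M D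
  divide-out D G≢1 = D′ , M′<M
    where
    open Dilation D
    G : ℕ
    G = gcdFold n (λ k → c (elem k)) (suc M)
    G∣M+1 : G ∣ suc M
    G∣M+1 = gcdFold∣init n (λ k → c (elem k)) (suc M)
    G∣c : ∀ {x} → x ∈ A → G ∣ c x
    G∣c x∈A = subst (λ y → G ∣ c y) (elem-index x∈A) (gcdFold∣entry n (λ k → c (elem k)) (suc M) (index x∈A))
    G≢0 : G ≢ 0
    G≢0 G≡0 = 1+n≢0 (0∣⇒≡0 (subst (_∣ suc M) G≡0 G∣M+1))
    instance
      G-nonZero : NonZero G
      G-nonZero = ≢-nonZero G≢0
    1<G : 1 < G
    1<G = ≤∧≢⇒< (n≢0⇒n>0 G≢0) (λ 1≡G → G≢1 (sym 1≡G))
    G≤M+1 : G ≤ suc M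
    G≤M+1 = ∣⇒≤ G∣M+1
    w : ℕ
    w = proj₁ (inverse p-prime G (≤-<-trans G≤M+1 M<p))
    wG≡1 : w * G ≡ 1 mod p
    wG≡1 = proj₂ (inverse p-prime G (≤-<-trans G≤M+1 M<p))
    M′ : ℕ
    M′ = suc M / G ∸ 1
    M′+1≡ : suc M′ ≡ suc M / G
    M′+1≡ = m+[n∸m]≡n (m≥n⇒m/n>0 G≤M+1)
    residue′ : ∀ {x} → x ∈ A → w * T * toℕ x ≡ c x / G mod p
    residue′ {x} x∈A = begin
      w * T * toℕ x          ≡⟨ *-assoc w T (toℕ x) ⟩
      w * (T * toℕ x)        ≈⟨ ≡mod-*ˡ w (c-residue x∈A) ⟩
      w * c x                ≡⟨ cong (w *_) (m*[n/m]≡n (G∣c x∈A)) ⟨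
      w * (G * (c x / G))    ≡⟨ *-assoc w G (c x / G) ⟨
      w * G * (c x / G)      ≈⟨ ≡mod-* wG≡1 (≡mod-refl (c x / G)) ⟩
      1 * (c x / G)          ≡⟨ *-identityˡ (c x / G) ⟩
      c x / G                ∎
      where open ≡mod-Reasoning p
    D′ : Dilation
    D′ = record
      { T = w * T
      ; M = M′
      ; c = λ x → c x / G
      ; top = top
      ; top∈A = top∈A
      ; c-top = trans (cong (_/ G) c-top) (sym M′+1≡)
      ; c-residue = residue′
      ; c-positive = λ x∈A → m≥n⇒m/n>0 (∣⇒≤-positive (G∣c x∈A) (c-positive x∈A))
      ; c-bounded = λ {x} x∈A → subst (c x / G ≤_) (sym M′+1≡) (/-monoˡ-≤ G (c-bounded x∈A))
      ; M<p = subst (_< p) (sym M′+1≡) (≤-<-trans (m/n≤m (suc M) G) M<p) }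
    M′<M : M′ < M
    M′<M = s≤s⁻¹ (subst (_< suc M) (sym M′+1≡) (m/n<m (suc M) G 1<G))

  Normalisation : Dilation → Set
  Normalisation D = ∃ λ D′ → DilationFacts.Primitive D′ × Dilation.M D′ ≤ Dilation.M D

  normalise : (D : Dilation) → Normalisation D
  normalise D = go (suc (Dilation.M D)) D ≤-refl
    where
    go : ∀ bound D → Dilation.M D < bound → Normalisation D
    go (suc bound) D M<bound = decide (gcdFold n (λ k → Dilation.c D (elem k)) (suc (Dilation.M D)) ≟ 1)
      where
      decide : Dec (DilationFacts.Primitive D) → Normalisation D
      decide (yes coprime) = D , coprime , ≤-refl
      decide (no G≢1) = descend (divide-out D G≢1)
        where
        descend : (∃ λ D′ → Dilation.M D′ < Dilation.M D) → Normalisation D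
        descend (D′ , M′<M) = weaken (go bound D′ (≤-trans M′<M (s≤s⁻¹ M<bound)))
          where
          weaken : Normalisation D′ → Normalisation D
          weaken (D″ , coprime , M″≤M′) = D″ , coprime , ≤-trans M″≤M′ (<⇒≤ M′<M)

  -- Any dilation with L(M+1) ≤ p, where Lⁿ < p ≤ (L+1)ⁿ and L ≥ 2, yields the
  -- theorem: normalise it, then compare Mⁿ with p.
  dilation-conclusion : 2 ≤ n → ∀ L → 2 ≤ L → L ^ n < p → p ≤ suc L ^ n →
                        (D : Dilation) → L * suc (Dilation.M D) ≤ p → Conclusion
  dilation-conclusion 2≤n L 2≤L Lⁿ<p p≤[L+1]ⁿ D L[M+1]≤p = from-normal (normalise D)
    where
    from-normal : Normalisation D → Conclusion
    from-normal (D′ , coprime , M′≤M) = compare (M′ ^ n <? p)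
      where
      open DilationFacts D′
      M′ : ℕ
      M′ = Dilation.M D′
      compare : Dec (M′ ^ n < p) → Conclusion
      compare (yes M′ⁿ<p) = block-case coprime 2≤n M′ⁿ<p
      compare (no M′ⁿ≮p) = large-case coprime L 2≤L Lⁿ<p p≤[L+1]ⁿ
                             (≤-trans (*-monoʳ-≤ L (s≤s M′≤M)) L[M+1]≤p) (≮⇒≥ M′ⁿ≮p)

  module Dirichlet (0∉A : 0ₚ ∉ A) (L : ℕ) (2≤L : 2 ≤ L) (Lⁿ<p : L ^ n < p) (p≤[L+1]ⁿ : p ≤ suc L ^ n) where
    open WithoutZero 0∉A

    instance
      L-nonZero : NonZero L
      L-nonZero = >-nonZero (≤-trans (s≤s z≤n) 2≤L)

    -- [0, p) is covered by L blocks of width s = q + 1, where q = ⌊(p-1)/L⌋.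
    q s : ℕ
    q = (p ∸ 1) / L
    s = suc q

    p-1<p : p ∸ 1 < p
    p-1<p = ∸-monoʳ-< (s≤s z≤n) 1≤p

    Lq<p : L * q < p
    Lq<p = ≤-<-trans (subst (_≤ p ∸ 1) (*-comm q L) (m/n*n≤m (p ∸ 1) L)) p-1<p

    s≤p : s ≤ p
    s≤p = ≤-<-trans (m≤n*m q L) Lq<p

    block : ∀ y → y < p → Fin L
    block y y<p = fromℕ< (m<n*o⇒m/o<n {y} {L} {s} (begin-strict
      y                        ≤⟨ s≤s⁻¹ (subst (y <_) (sym (m+[n∸m]≡n 1≤p)) y<p) ⟩
      p ∸ 1                    ≡⟨ m≡m%n+[m/n]*n (p ∸ 1) L ⟩
      (p ∸ 1) % L + q * L      <⟨ +-monoˡ-< (q * L) (m%n<n (p ∸ 1) L) ⟩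
      L + q * L                ≡⟨ *-comm s L ⟩
      L * s                    ∎))
      where open ≤-Reasoning

    Above Below : ℕ → Fin p → Set
    Above t x = ∃ λ u → u < s × t * toℕ x ≡ u mod p
    Below t x = ∃ λ v → v < s × t * toℕ x + v ≡ 0 mod p

    residue : ℕ → Fin n → ℕ
    residue t k = (t * toℕ (elem k)) % p

    blocks : Fin p → Fin (L ^ n)
    blocks t = Fin.funToFin (λ k → block (residue (toℕ t) k) (m%n<n _ p))

    -- Two multipliers t₁ < t₂ placing every a_k in the same block: their
    -- difference t moves each a_k by less than s, up or down.
    approximation-from-collision : ∀ t₁ t₂ → t₁ < t₂ → (∀ k → residue t₁ k / s ≡ residue t₂ k / s) →
                                   ∀ k → Above (t₂ ∸ t₁) (elem k) ⊎ Below (t₂ ∸ t₁) (elem k)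
    approximation-from-collision t₁ t₂ t₁<t₂ same k = by-order (y₁ ≤? y₂)
      where
      a y₁ y₂ : ℕ
      a = toℕ (elem k)
      y₁ = residue t₁ k
      y₂ = residue t₂ k
      split : t₁ * a + (t₂ ∸ t₁) * a ≡ t₂ * a mod p
      split = ≡⇒≡mod (trans (sym (*-distribʳ-+ a t₁ (t₂ ∸ t₁))) (cong (_* a) (m+[n∸m]≡n (<⇒≤ t₁<t₂))))
      by-order : Dec (y₁ ≤ y₂) → Above (t₂ ∸ t₁) (elem k) ⊎ Below (t₂ ∸ t₁) (elem k)
      by-order (yes y₁≤y₂) = inj₁ (y₂ ∸ y₁ , m<n+o⇒m∸n<o y₂ y₁ (same-block s y₁ y₂ y₁≤y₂ (same k)) ,
                                   difference-≤ split y₁≤y₂)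
      by-order (no y₁≰y₂) = inj₂ (y₁ ∸ y₂ , m<n+o⇒m∸n<o y₁ y₂ (same-block s y₂ y₁ y₂≤y₁ (sym (same k))) ,
                                  difference-≥ split y₂≤y₁)
        where
        y₂≤y₁ : y₂ ≤ y₁
        y₂≤y₁ = <⇒≤ (≰⇒> y₁≰y₂)

    -- Dirichlet's principle: the p patterns cannot all differ since Lⁿ < p.
    simultaneous-approximation : ∃ λ t → 1 ≤ t × t < p × ∀ k → Above t (elem k) ⊎ Below t (elem k)
    simultaneous-approximation = from-collision (Finₚ.pigeonhole Lⁿ<p blocks)
      where
      from-collision : (∃ λ t₁ → ∃ λ t₂ → t₁ Fin.< t₂ × blocks t₁ ≡ blocks t₂) →
                       ∃ λ t → 1 ≤ t × t < p × ∀ k → Above t (elem k) ⊎ Below t (elem k)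
      from-collision (t₁ , t₂ , t₁<t₂ , same-pattern) =
        toℕ t₂ ∸ toℕ t₁ , m<n⇒0<n∸m t₁<t₂ , ≤-<-trans (m∸n≤m (toℕ t₂) (toℕ t₁)) (Finₚ.toℕ<n t₂) ,
        approximation-from-collision (toℕ t₁) (toℕ t₂) t₁<t₂ same-block-index
        where
        same-block-index : ∀ k → residue (toℕ t₁) k / s ≡ residue (toℕ t₂) k / s
        same-block-index k = trans (sym (Finₚ.toℕ-fromℕ< _)) (trans (cong toℕ blocks≡) (Finₚ.toℕ-fromℕ< _))
          where
          blocks≡ : block (residue (toℕ t₁) k) (m%n<n _ p) ≡ block (residue (toℕ t₂) k) (m%n<n _ p)
          blocks≡ = trans (sym (Finₚ.finToFun-funToFin _ k))
                      (trans (cong (λ f → Fin.finToFun f k) same-pattern) (Finₚ.finToFun-funToFin _ k))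

    -- Opposite signs: if t·x ≡ u and t·y + v ≡ 0, then v copies of x and u
    -- copies of y form a zero sum, as t(vx + uy) ≡ vu + u·ty ≡ u(ty + v) ≡ 0.
    opposite-zero-sum : ∀ {t u v} x y → ¬ (p ∣ t) → t * toℕ x ≡ u mod p → t * toℕ y + v ≡ 0 mod p →
                        p ∣ weight (replicate v x ++ replicate u y)
    opposite-zero-sum {t} {u} {v} x y p∤t tx≡u ty+v≡0 = cancel-t (euclidsLemma t (weight Z) p-prime (≡0⇒∣ tΣ≡0))
      where
      open ≡mod-Reasoning p
      X Y : ℕ
      X = toℕ x
      Y = toℕ y
      Z : List (Fin p)
      Z = replicate v x ++ replicate u y
      ΣZ : weight Z ≡ v * X + u * Y
      ΣZ = trans (sumBy-++ toℕ (replicate v x) (replicate u y))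
                 (cong₂ _+_ (sumBy-replicate toℕ v x) (sumBy-replicate toℕ u y))
      tΣ≡0 : t * weight Z ≡ 0 mod p
      tΣ≡0 = begin
        t * weight Z               ≡⟨ cong (t *_) ΣZ ⟩
        t * (v * X + u * Y)        ≡⟨ distribute t v X u Y ⟩
        v * (t * X) + u * (t * Y)  ≈⟨ ≡mod-+ (≡mod-*ˡ v tx≡u) (≡mod-refl (u * (t * Y))) ⟩
        v * u + u * (t * Y)        ≡⟨ factor v u t Y ⟩
        u * (t * Y + v)            ≈⟨ ≡mod-*ˡ u ty+v≡0 ⟩
        u * 0                      ≡⟨ *-zeroʳ u ⟩
        0                          ∎
        where
        distribute : ∀ t v X u Y → t * (v * X + u * Y) ≡ v * (t * X) + u * (t * Y)
        distribute = solve-∀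
        factor : ∀ v u t Y → v * u + u * (t * Y) ≡ u * (t * Y + v)
        factor = solve-∀
      cancel-t : (p ∣ t) ⊎ (p ∣ weight Z) → p ∣ weight Z
      cancel-t (inj₁ p∣t) = ⊥-elim (p∤t p∣t)
      cancel-t (inj₂ p∣Σ) = p∣Σ

    -- Mixed signs give h ≤ u + v ≤ 2q, hence (h-1)(L+1) < 3p.
    mixed-case : ∀ {t} → 1 ≤ t → t < p → ∀ {k k′} → Above t (elem k) → Below t (elem k′) → Conclusion
    mixed-case {t} 1≤t t<p {k} {k′} (u , u<s , tx≡u) (v , v<s , ty+v≡0) =
      small (suc L) (mixed-inequality L q p h 2≤L Lq<p h≤2q) p≤[L+1]ⁿ
      where
      p∤t : ¬ (p ∣ t)
      p∤t = ¬∣-below 1≤t t<p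
      Z : List (Fin p)
      Z = replicate v (elem k) ++ replicate u (elem k′)
      len-Z : length Z ≡ v + u
      len-Z = trans (length-++ (replicate v (elem k))) (cong₂ _+_ (length-replicate v) (length-replicate u))
      1≤v : ∀ v → t * toℕ (elem k′) + v ≡ 0 mod p → 1 ≤ v
      1≤v zero ty≡0 = ⊥-elim (¬≡0-multiple p∤t (member k′) (≡mod-trans (≡⇒≡mod (sym (+-identityʳ _))) ty≡0))
      1≤v (suc v) _ = s≤s z≤n
      h≤2q : h ≤ q + q
      h≤2q = ≤-trans
        (subst (h ≤_) len-Z (coheight-minimal coheight Z
          (Allₚ.++⁺ (Allₚ.replicate⁺ v (member k)) (Allₚ.replicate⁺ u (member k′)) ,
           opposite-zero-sum (elem k) (elem k′) p∤t tx≡u ty+v≡0)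
          (subst (1 ≤_) (sym len-Z) (≤-trans (1≤v v ty+v≡0) (m≤m+n v u)))))
        (+-mono-≤ (s≤s⁻¹ v<s) (s≤s⁻¹ u<s))

    reflect : ∀ {t x} → t ≤ p → Below t x → Above (p ∸ t) x
    reflect {t} {x} t≤p (v , v<s , tx+v≡0) = v , v<s , ≡mod-cancelˡ (t * toℕ x) (begin
      t * toℕ x + (p ∸ t) * toℕ x   ≡⟨ *-distribʳ-+ (toℕ x) t (p ∸ t) ⟨
      (t + (p ∸ t)) * toℕ x         ≡⟨ cong (_* toℕ x) (m+[n∸m]≡n t≤p) ⟩
      p * toℕ x                     ≡⟨ *-comm p (toℕ x) ⟩
      toℕ x * p                     ≈⟨ multiple≡0 (toℕ x) ⟩
      0                             ≈⟨ tx+v≡0 ⟨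
      t * toℕ x + v                 ∎)
      where open ≡mod-Reasoning p

    -- If every T·a lies just above 0, the residues of T·x form a dilation
    -- with maximum M + 1 ≤ q, so L(M+1) ≤ Lq < p.
    above-dilation : ∀ T → 1 ≤ T → T < p → (∀ k → Above T (elem k)) → ∃ λ D → L * suc (Dilation.M D) ≤ p
    above-dilation T 1≤T T<p above = D , ≤-trans (*-monoʳ-≤ L M+1≤q) (<⇒≤ Lq<p)
      where
      c : Fin p → ℕ
      c x = (T * toℕ x) % p
      residue-bounds : ∀ k → 1 ≤ c (elem k) × c (elem k) ≤ q
      residue-bounds k = from-above (above k)
        where
        from-above : Above T (elem k) → 1 ≤ c (elem k) × c (elem k) ≤ q
        from-above (u , u<s , Ta≡u) = subst (1 ≤_) (sym c≡u) (1≤u u Ta≡u) , subst (_≤ q) (sym c≡u) (s≤s⁻¹ u<s)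
          where
          c≡u : c (elem k) ≡ u
          c≡u = ≡mod⇒≡ (≡mod-trans (≡mod-sym (≡% _)) Ta≡u) (m%n<n _ p) (<-≤-trans u<s s≤p)
          1≤u : ∀ u → T * toℕ (elem k) ≡ u mod p → 1 ≤ u
          1≤u zero Ta≡0 = ⊥-elim (¬≡0-multiple (¬∣-below 1≤T T<p) (member k) Ta≡0)
          1≤u (suc u) _ = s≤s z≤n
      on-A : {P : ℕ → Set} → (∀ k → P (c (elem k))) → ∀ {x} → x ∈ A → P (c x)
      on-A {P} Pk x∈A = subst (λ y → P (c y)) (elem-index x∈A) (Pk (index x∈A))
      k-top : Fin n
      k-top = proj₁ (argmax 1≤n (λ k → c (elem k)))
      M : ℕ
      M = c (elem k-top) ∸ 1
      M+1≡ : suc M ≡ c (elem k-top)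
      M+1≡ = m+[n∸m]≡n (proj₁ (residue-bounds k-top))
      M+1≤q : suc M ≤ q
      M+1≤q = subst (_≤ q) (sym M+1≡) (proj₂ (residue-bounds k-top))
      D : Dilation
      D = record
        { T = T
        ; M = M
        ; c = c
        ; top = elem k-top
        ; top∈A = member k-top
        ; c-top = sym M+1≡
        ; c-residue = λ {x} _ → ≡% (T * toℕ x)
        ; c-positive = on-A {1 ≤_} (λ k → proj₁ (residue-bounds k))
        ; c-bounded = on-A {_≤ suc M} (λ k → subst (c (elem k) ≤_) (sym M+1≡) (proj₂ (argmax 1≤n (λ k → c (elem k))) k))
        ; M<p = <-≤-trans (s≤s M+1≤q) s≤p }

    conclusion : 2 ≤ n → Conclusion
    conclusion 2≤n = from-approximation simultaneous-approximation
      where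
      via-dilation : (∃ λ D → L * suc (Dilation.M D) ≤ p) → Conclusion
      via-dilation (D , L[M+1]≤p) = dilation-conclusion 2≤n L 2≤L Lⁿ<p p≤[L+1]ⁿ D L[M+1]≤p
      from-approximation : (∃ λ t → 1 ≤ t × t < p × ∀ k → Above t (elem k) ⊎ Below t (elem k)) → Conclusion
      from-approximation (t , 1≤t , t<p , near) = by-signs (uniform-or-mixed near)
        where
        by-signs : (∀ k → Above t (elem k)) ⊎ (∀ k → Below t (elem k)) ⊎
                   ((∃ λ k → Above t (elem k)) × (∃ λ k → Below t (elem k))) → Conclusion
        by-signs (inj₁ above) = via-dilation (above-dilation t 1≤t t<p above)
        by-signs (inj₂ (inj₁ below)) = via-dilation (above-dilation (p ∸ t) (m<n⇒0<n∸m t<p)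
                                         (∸-monoʳ-< 1≤t (<⇒≤ t<p)) (λ k → reflect (<⇒≤ t<p) (below k)))
        by-signs (inj₂ (inj₂ ((k , above) , (k′ , below)))) = mixed-case 1≤t t<p above below

theorem3 : (p n : ℕ) → Prime p → (A : Subset p) → ∣ A ∣ ≡ n → 1 ≤ n →
    (h : ℕ) → IsCoheight p A h →
    ((0 < h) × ((h ∸ 1) ^ n < (3 ^ n) * (p ^ (n ∸ 1))))
    ⊎ (∃ λ (b : ℕ) → (n ≤ b) × ((b ∸ 1) ^ n < p) × (p ≤ b * h) × (b * h < p + b * b))
theorem3 p n p-prime A |A|≡n 1≤n h coheight = by-zero (0ₚ ∈? A)
  where
  open CoheightBound p-prime (subst (Enumeration A) |A|≡n (enumerate A)) 1≤n coheight
  by-root : 0ₚ ∉ A → 2 ≤ n → (∃ λ L → L ^ n < p × p ≤ suc L ^ n) → Conclusion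
  by-root 0∉A 2≤n (L , Lⁿ<p , p≤[L+1]ⁿ) = by-L (L ≤? 1)
    where
    by-L : Dec (L ≤ 1) → Conclusion
    by-L (yes L≤1) = small-root (suc L) (s≤s L≤1) p≤[L+1]ⁿ
    by-L (no L≰1) = Dirichlet.conclusion 0∉A L (≰⇒> L≰1) Lⁿ<p p≤[L+1]ⁿ 2≤n
  by-size : 0ₚ ∉ A → Dec (n ≡ 1) → Conclusion
  by-size 0∉A (yes n≡1) = WithoutZero.singleton 0∉A n≡1
  by-size 0∉A (no n≢1) = by-root 0∉A (≤∧≢⇒< 1≤n (λ 1≡n → n≢1 (sym 1≡n))) (integer-root p n 1<p 1≤n)
  by-zero : Dec (0ₚ ∈ A) → Conclusion
  by-zero (yes 0∈A) = zero-member 0∈A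
  by-zero (no 0∉A) = by-size 0∉A (n ≟ 1)
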